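{- Let $w$ be the Arshon sequence over the alphabet $\{1,2,3\}$. There does not exist a morphism $\varphi:\{1,2,3\}^{\star}\to\{1,2,3\}^{\star}$ having $w$ as a fixed point; that is, there is no morphism $\varphi$ and letter $a\in\{1,2,3\}$ such that $\varphi(a)$ begins with $a$, the lengths $|\varphi^k(a)|$ increase without bound, and $\lim_{k\to\infty}\varphi^k(a)=w$.
   Context: The Arshon sequence is defined as follows. Let $w_1=1$. For $k\ge 1$, the word $w_{k+1}$ is obtained from $w_k$ by replacing each letter in an odd position (positions counted from $1$) according to $1\mapsto 123$, $2\mapsto 231$, $3\mapsto 312$, and each letter in an even position according to $1\mapsto 321$, $2\mapsto 132$, $3\mapsto 213$. Thus $w_2=123$, $w_3=123132312$, and each $w_k$ is a prefix of $w_{k+1}$; the Arshon sequence is the infinite sequence $w=\lim_{k\to\infty}w_k$. A morphism $\varphi$ on $\Sigma^{\star}$ (the set of finite words over $\Sigma$) is a map with $\varphi(uv)=\varphi(u)\varphi(v)$ for all words $u,v$. If $\varphi(a)$ begins with $a$ and $|\varphi^k(a)|$ increases without bound, then each $\varphi^k(a)$ is a prefix of $\varphi^{k+1}(a)$ and the infinite sequence $\lim_{k\to\infty}\varphi^k(a)$ is called a fixed point of $\varphi$. -}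

module Defs where

open import Data.Nat using (ℕ; zero; suc; _<_)
open import Data.List using (List; []; _∷_; _++_; concatMap; length)
open import Data.Maybe using (Maybe; just; nothing; fromMaybe)
open import Data.Product using (∃; _×_; Σ)
open import Relation.Nullary using (¬_)
open import Relation.Binary.PropositionalEquality using (_≡_)

data Letter : Set where
  l1 l2 l3 : Letter

Word : Set
Word = List Letter

-- Arshon substitution for letters in odd positions (1-indexed)
oddImg : Letter → Word
oddImg l1 = l1 ∷ l2 ∷ l3 ∷ []
oddImg l2 = l2 ∷ l3 ∷ l1 ∷ []
oddImg l3 = l3 ∷ l1 ∷ l2 ∷ []

-- Arshon substitution for letters in even positions (1-indexed)
evenImg : Letter → Word
evenImg l1 = l3 ∷ l2 ∷ l1 ∷ []
evenImg l2 = l1 ∷ l3 ∷ l2 ∷ []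
evenImg l3 = l2 ∷ l1 ∷ l3 ∷ []

mutual
  stepOdd : Word → Word
  stepOdd []       = []
  stepOdd (x ∷ xs) = oddImg x ++ stepEven xs

  stepEven : Word → Word
  stepEven []       = []
  stepEven (x ∷ xs) = evenImg x ++ stepOdd xs

-- w_k for k ≥ 1: arshonWord k = w_(k+1), so arshonWord 0 = w_1 = 1
arshonWord : ℕ → Word
arshonWord zero    = l1 ∷ []
arshonWord (suc k) = stepOdd (arshonWord k)

at : Word → ℕ → Maybe Letter
at []       _       = nothing
at (x ∷ xs) zero    = just x
at (x ∷ xs) (suc n) = at xs n

-- The Arshon sequence w : ℕ → Letter (0-indexed); position n is read from
-- w_(n+1) = arshonWord n, which has length 3^n > n (the default is never used).
arshon : ℕ → Letter
arshon n = fromMaybe l1 (at (arshonWord n) n)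

Morphism : Set
Morphism = Letter → Word

applyM : Morphism → Word → Word
applyM φ = concatMap φ

iterM : Morphism → ℕ → Word → Word
iterM φ zero    u = u
iterM φ (suc k) u = applyM φ (iterM φ k u)

BeginsWith : Word → Letter → Set
BeginsWith []       a = Data.Empty.⊥
  where import Data.Empty
BeginsWith (x ∷ _)  a = x ≡ a

Unbounded : Morphism → Letter → Set
Unbounded φ a = ∀ (N : ℕ) → ∃ λ k → N < length (iterM φ k (a ∷ []))

LimitIs : Morphism → Letter → (ℕ → Letter) → Set
LimitIs φ a s = ∀ (n : ℕ) → ∃ λ k → at (iterM φ k (a ∷ [])) n ≡ just (s n)

FixedPointFrom : Morphism → Letter → (ℕ → Letter) → Set
FixedPointFrom φ a s = BeginsWith (φ a) a × Unbounded φ a × LimitIs φ a s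

{-# OPTIONS --safe #-}
module Submission where

-- If φ fixes w, let f x = |φ x|. Cutting w after the images of w 0, w 1, … gives blocks that
-- depend only on the letter they come from. An Arshon block of three letters ascends cyclically
-- at even index and descends at odd index, and w has no squares of length 2 or 4; together
-- these make every factor of length 10 determine its position modulo 6. So if some |φ x| ≥ 10,
-- the images lying between the two x's of the factors xyx, xzx and xyzx have total length
-- divisible by 6, whence 6 divides every |φ y|. As w (3m) is the first letter of the m-th
-- Arshon block, which determines w m, the even lengths f/3 then fix w as well. By induction on
-- |φ 1| every fixing length function with |φ 1| > 0 is constantly 1: lengths ≤ 9 are settled
-- by a finite search, and a length ≥ 10 would make the even f/3 constantly 1. So |φ^k(a)| = 1
-- for all k, contradicting unbounded growth.

open import Defs
open import Data.Empty using (⊥)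
open import Data.Bool using (Bool; true; false; not; _∧_; if_then_else_)
open import Data.List using ([]; _∷_; _++_; length; concatMap; applyUpTo)
open import Data.List.Properties using (++-assoc; ++-identityʳ; length-++; concatMap-++)
open import Data.Maybe using (just; fromMaybe)
import Data.Maybe as Maybe
open import Data.Maybe.Properties using (just-injective)
open import Data.Nat
open import Data.Nat.Properties
open import Data.Nat.DivMod
open import Data.Nat.Divisibility
open import Data.Nat.Induction using (<-rec)
open import Data.Product using (∃; ∃₂; _×_; _,_; proj₁; proj₂)
open import Data.Sum using (inj₁; inj₂)
open import Function using (_∘_)
open import Relation.Nullary using (¬_; Dec; yes; no; does; contradiction)
open import Relation.Nullary.Decidable using (map′; from-yes; _×-dec_; _⊎-dec_; _→-dec_; ¬?)
open import Relation.Unary using (Decidable)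
open import Relation.Binary.PropositionalEquality

w : ℕ → Letter
w = arshon

infix 4 _≟ᴸ_
_≟ᴸ_ : (x y : Letter) → Dec (x ≡ y)
l1 ≟ᴸ l1 = yes refl
l1 ≟ᴸ l2 = no λ ()
l1 ≟ᴸ l3 = no λ ()
l2 ≟ᴸ l1 = no λ ()
l2 ≟ᴸ l2 = yes refl
l2 ≟ᴸ l3 = no λ ()
l3 ≟ᴸ l1 = no λ ()
l3 ≟ᴸ l2 = no λ ()
l3 ≟ᴸ l3 = yes refl

∀-Letter? : ∀ {P : Letter → Set} → Decidable P → Dec (∀ x → P x)
∀-Letter? P? = map′ (λ { (p , q , r) → λ { l1 → p ; l2 → q ; l3 → r } })
                    (λ h → h l1 , h l2 , h l3)
                    (P? l1 ×-dec P? l2 ×-dec P? l3)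

∃-Letter? : ∀ {P : Letter → Set} → Decidable P → Dec (∃ P)
∃-Letter? P? = map′ (λ { (inj₁ p) → l1 , p ; (inj₂ (inj₁ q)) → l2 , q ; (inj₂ (inj₂ r)) → l3 , r })
                    (λ { (l1 , p) → inj₁ p ; (l2 , q) → inj₂ (inj₁ q) ; (l3 , r) → inj₂ (inj₂ r) })
                    (P? l1 ⊎-dec P? l2 ⊎-dec P? l3)

∀-Bool? : ∀ {P : Bool → Set} → Decidable P → Dec (∀ b → P b)
∀-Bool? P? = map′ (λ { (p , q) → λ { false → p ; true → q } })
                  (λ h → h false , h true)
                  (P? false ×-dec P? true)

next : Letter → Letter
next l1 = l2
next l2 = l3
next l3 = l1

every-letter : ∀ x {P : Letter → Set} → P x × P (next x) × P (next (next x)) → ∀ y → P y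
every-letter l1 (p , q , r) = λ { l1 → p ; l2 → q ; l3 → r }
every-letter l2 (p , q , r) = λ { l1 → r ; l2 → p ; l3 → q }
every-letter l3 (p , q , r) = λ { l1 → q ; l2 → r ; l3 → p }

letterAt : Word → ℕ → Letter
letterAt u n = fromMaybe l1 (at u n)

factor : (ℕ → Letter) → ℕ → ℕ → Word
factor g p n = applyUpTo (λ t → g (p + t)) n

at-++ˡ : ∀ u {v n} → n < length u → at (u ++ v) n ≡ at u n
at-++ˡ (x ∷ u) {n = zero}  _         = refl
at-++ˡ (x ∷ u) {n = suc n} (s≤s n<) = at-++ˡ u n<

at-++ʳ : ∀ u {v} n → at (u ++ v) (length u + n) ≡ at v n
at-++ʳ []      n = refl
at-++ʳ (x ∷ u) n = at-++ʳ u n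

at-letterAt : ∀ u {n} → n < length u → at u n ≡ just (letterAt u n)
at-letterAt (x ∷ u) {zero}  _         = refl
at-letterAt (x ∷ u) {suc n} (s≤s n<) = at-letterAt u n<

at-applyUpTo : ∀ (g : ℕ → Letter) {n i} → i < n → at (applyUpTo g n) i ≡ just (g i)
at-applyUpTo g {suc n} {zero}  _         = refl
at-applyUpTo g {suc n} {suc i} (s≤s i<) = at-applyUpTo (g ∘ suc) i<

applyUpTo-cong : ∀ {f g : ℕ → Letter} n → (∀ {t} → t < n → f t ≡ g t) → applyUpTo f n ≡ applyUpTo g n
applyUpTo-cong zero    eq = refl
applyUpTo-cong (suc n) eq = cong₂ _∷_ (eq z<s) (applyUpTo-cong n (eq ∘ s≤s))

infix 4 _≼_
_≼_ : Word → Word → Set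
u ≼ v = ∃ λ t → v ≡ u ++ t

≼-refl : ∀ {u} → u ≼ u
≼-refl {u} = [] , sym (++-identityʳ u)

≼-trans : ∀ {u v x} → u ≼ v → v ≼ x → u ≼ x
≼-trans {u} (t , refl) (t′ , refl) = t ++ t′ , ++-assoc u t t′

at-≼ : ∀ {u v n y} → u ≼ v → at u n ≡ just y → at v n ≡ just y
at-≼ {x ∷ u} {n = zero}  (t , refl) e = e
at-≼ {x ∷ u} {n = suc n} (t , refl) e = at-≼ {u} (t , refl) e

module PrefixChain (u : ℕ → Word) (grows : ∀ k → u k ≼ u (suc k)) where

  ≼-chain : ∀ {k m} → k ≤′ m → u k ≼ u m
  ≼-chain ≤′-refl         = ≼-refl
  ≼-chain (≤′-step k≤′m) = ≼-trans (≼-chain k≤′m) (grows _)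

  limit-unique : ∀ {g : ℕ → Letter} → (∀ n → ∃ λ k → at (u k) n ≡ just (g n)) →
                 ∀ {k n y} → at (u k) n ≡ just y → y ≡ g n
  limit-unique limit {k} {n} e with limit n
  ... | k′ , e′ with ≤-total k k′
  ...   | inj₁ k≤k′ = just-injective (trans (sym (at-≼ (≼-chain (≤⇒≤′ k≤k′)) e)) e′)
  ...   | inj₂ k′≤k = just-injective (trans (sym e) (at-≼ (≼-chain (≤⇒≤′ k′≤k)) e′))

-- The block structure of the Arshon sequence

-- The flag is the parity of the 0-based block index: false (even index) selects oddImg, the
-- image at odd 1-based positions.
img : Bool → Letter → Word
img false = oddImg
img true  = evenImg

blockLetter : Bool → Letter → ℕ → Letter
blockLetter b x = letterAt (img b x)

step : Bool → Word → Word
step b []      = []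
step b (x ∷ u) = img b x ++ step (not b) u

flips : Bool → ℕ → Bool
flips b zero    = b
flips b (suc i) = flips (not b) i

isOdd : ℕ → Bool
isOdd = flips false

flips-+ : ∀ b m n → flips b (m + n) ≡ flips (flips b m) n
flips-+ b zero    n = refl
flips-+ b (suc m) n = flips-+ (not b) m n

isOdd-double : ∀ q → isOdd (q * 2) ≡ false
isOdd-double zero    = refl
isOdd-double (suc q) = isOdd-double q

isOdd-+-even : ∀ {m} j → 2 ∣ m → isOdd (m + j) ≡ isOdd j
isOdd-+-even j (divides-refl q) = trans (flips-+ false (q * 2) j) (cong (λ b → flips b j) (isOdd-double q))

mutual
  step-false : ∀ u → step false u ≡ stepOdd u
  step-false []      = refl
  step-false (x ∷ u) = cong (oddImg x ++_) (step-true u)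

  step-true : ∀ u → step true u ≡ stepEven u
  step-true []      = refl
  step-true (x ∷ u) = cong (evenImg x ++_) (step-false u)

length-img : ∀ b x → length (img b x) ≡ 3
length-img = from-yes (∀-Bool? λ b → ∀-Letter? λ x → length (img b x) ≟ 3)

length-step : ∀ b u → length (step b u) ≡ length u * 3
length-step b []      = refl
length-step b (x ∷ u) = begin
  length (img b x ++ step (not b) u)           ≡⟨ length-++ (img b x) ⟩
  length (img b x) + length (step (not b) u)   ≡⟨ cong₂ _+_ (length-img b x) (length-step (not b) u) ⟩
  3 + length u * 3                             ∎
  where open ≡-Reasoning

step-++ : ∀ b u v → step b (u ++ v) ≡ step b u ++ step (flips b (length u)) v
step-++ b []      v = refl
step-++ b (x ∷ u) v = trans (cong (img b x ++_) (step-++ (not b) u v)) (sym (++-assoc (img b x) _ _))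

at-step : ∀ b u i {r} → r < 3 →
          at (step b u) (i * 3 + r) ≡ Maybe.map (λ x → blockLetter (flips b i) x r) (at u i)
at-step b []      i       r<3 = refl
at-step b (x ∷ u) zero {r} r<3 = begin
  at (img b x ++ step (not b) u) r   ≡⟨ at-++ˡ (img b x) r<length ⟩
  at (img b x) r                     ≡⟨ at-letterAt (img b x) r<length ⟩
  just (blockLetter b x r)           ∎
  where
  open ≡-Reasoning
  r<length = subst (r <_) (sym (length-img b x)) r<3
at-step b (x ∷ u) (suc i) {r} r<3 = begin
  at (img b x ++ step (not b) u) (3 + (i * 3 + r))
    ≡⟨ cong (λ n → at (img b x ++ step (not b) u) (n + (i * 3 + r))) (sym (length-img b x)) ⟩
  at (img b x ++ step (not b) u) (length (img b x) + (i * 3 + r))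
    ≡⟨ at-++ʳ (img b x) (i * 3 + r) ⟩
  at (step (not b) u) (i * 3 + r)
    ≡⟨ at-step (not b) u i r<3 ⟩
  Maybe.map (λ y → blockLetter (flips (not b) i) y r) (at u i)
    ∎
  where open ≡-Reasoning

arshonWord-grows : ∀ k → arshonWord k ≼ arshonWord (suc k)
arshonWord-grows zero    = l2 ∷ l3 ∷ [] , refl
arshonWord-grows (suc k) with arshonWord-grows k
... | t , e = t′ , (begin
  stepOdd (arshonWord (suc k))        ≡⟨ sym (step-false (arshonWord (suc k))) ⟩
  step false (arshonWord (suc k))     ≡⟨ cong (step false) e ⟩
  step false (arshonWord k ++ t)      ≡⟨ step-++ false (arshonWord k) t ⟩
  step false (arshonWord k) ++ t′     ≡⟨ cong (_++ t′) (step-false (arshonWord k)) ⟩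
  stepOdd (arshonWord k) ++ t′        ∎)
  where
  open ≡-Reasoning
  t′ = step (flips false (length (arshonWord k))) t

length-arshonWord : ∀ k → length (arshonWord k) ≡ 3 ^ k
length-arshonWord zero    = refl
length-arshonWord (suc k) = begin
  length (stepOdd (arshonWord k))       ≡⟨ cong length (sym (step-false (arshonWord k))) ⟩
  length (step false (arshonWord k))    ≡⟨ length-step false (arshonWord k) ⟩
  length (arshonWord k) * 3             ≡⟨ cong (_* 3) (length-arshonWord k) ⟩
  3 ^ k * 3                             ≡⟨ *-comm (3 ^ k) 3 ⟩
  3 ^ suc k                             ∎
  where open ≡-Reasoning

n<3^n : ∀ n → n < 3 ^ n
n<3^n zero    = z<s
n<3^n (suc n) = ≤-trans (+-mono-≤ (m^n>0 3 n) (n<3^n n)) (+-monoʳ-≤ (3 ^ n) (m≤m+n (3 ^ n) _))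

at-arshonWord : ∀ n → at (arshonWord n) n ≡ just (w n)
at-arshonWord n = at-letterAt (arshonWord n) (subst (n <_) (sym (length-arshonWord n)) (n<3^n n))

arshonWord-agrees : ∀ {k n y} → at (arshonWord k) n ≡ just y → y ≡ w n
arshonWord-agrees {k} = PrefixChain.limit-unique arshonWord arshonWord-grows (λ n → n , at-arshonWord n) {k}

w-block : ∀ i {r} → r < 3 → w (i * 3 + r) ≡ blockLetter (isOdd i) (w i) r
w-block i {r} r<3 = sym (arshonWord-agrees {suc i} (begin
  at (stepOdd (arshonWord i)) (i * 3 + r)        ≡⟨ cong (λ u → at u (i * 3 + r)) (sym (step-false (arshonWord i))) ⟩
  at (step false (arshonWord i)) (i * 3 + r)     ≡⟨ at-step false (arshonWord i) i r<3 ⟩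
  Maybe.map (λ x → blockLetter (isOdd i) x r) (at (arshonWord i) i)
                                                 ≡⟨ cong (Maybe.map _) (at-arshonWord i) ⟩
  just (blockLetter (isOdd i) (w i) r)           ∎))
  where open ≡-Reasoning

blockLetter-injective₀ : ∀ b x y → blockLetter b x 0 ≡ blockLetter b y 0 → x ≡ y
blockLetter-injective₀ = from-yes (∀-Bool? λ b → ∀-Letter? λ x → ∀-Letter? λ y →
  (blockLetter b x 0 ≟ᴸ blockLetter b y 0) →-dec (x ≟ᴸ y))

divMod3 : ∀ m → m ≡ m / 3 * 3 + m % 3
divMod3 m = trans (m≡m%n+[m/n]*n m 3) (+-comm (m % 3) _)

w-in-step : ∀ i k {q r} → q < k → r < 3 →
             w (i * 3 + (q * 3 + r)) ≡ letterAt (step (isOdd i) (factor w i k)) (q * 3 + r)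
w-in-step i k {q} {r} q<k r<3 = begin
  w (i * 3 + (q * 3 + r))
    ≡⟨ cong w (trans (sym (+-assoc (i * 3) (q * 3) r)) (cong (_+ r) (sym (*-distribʳ-+ 3 i q)))) ⟩
  w ((i + q) * 3 + r)
    ≡⟨ w-block (i + q) r<3 ⟩
  blockLetter (isOdd (i + q)) (w (i + q)) r
    ≡⟨ cong (λ b → blockLetter b (w (i + q)) r) (flips-+ false i q) ⟩
  blockLetter (flips (isOdd i) q) (w (i + q)) r
    ≡⟨ cong (fromMaybe l1) (sym (trans (at-step (isOdd i) (factor w i k) q r<3)
                                       (cong (Maybe.map _) (at-applyUpTo _ q<k)))) ⟩
  letterAt (step (isOdd i) (factor w i k)) (q * 3 + r)
    ∎
  where open ≡-Reasoning

factor-in-step : ∀ p k {n} → p % 3 + n ≤ k * 3 →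
           factor w p n ≡ factor (letterAt (step (isOdd (p / 3)) (factor w (p / 3) k))) (p % 3) n
factor-in-step p k {n} bound = trans (cong (λ p′ → factor w p′ n) (divMod3 p)) (applyUpTo-cong n inBlocks)
  where
  i = p / 3
  r = p % 3
  inBlocks : ∀ {t} → t < n → w (i * 3 + r + t) ≡ letterAt (step (isOdd i) (factor w i k)) (r + t)
  inBlocks {t} t<n =
    trans (cong w (+-assoc (i * 3) r t))
          (subst (λ m → w (i * 3 + m) ≡ letterAt (step (isOdd i) (factor w i k)) m)
                 (sym (divMod3 (r + t)))
                 (w-in-step i k (m<n*o⇒m/o<n (≤-trans (+-monoʳ-< r t<n) bound)) (m%n<n (r + t) 3)))

m%3+n≤2+n : ∀ m n → m % 3 + n ≤ 2 + n
m%3+n≤2+n m n = +-monoˡ-≤ n (≤-pred (m%n<n m 3))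

-- Square-freeness and synchronisation

SquareFree₄ : Word → Set
SquareFree₄ (a ∷ b ∷ c ∷ d ∷ []) = a ≢ b × b ≢ c × c ≢ d × ¬ (a ≡ c × b ≡ d)
SquareFree₄ _                    = ⊥

squareFree₄? : ∀ g p → Dec (SquareFree₄ (factor g p 4))
squareFree₄? g p = ¬? (g (p + 0) ≟ᴸ g (p + 1)) ×-dec ¬? (g (p + 1) ≟ᴸ g (p + 2)) ×-dec
                   ¬? (g (p + 2) ≟ᴸ g (p + 3)) ×-dec ¬? (g (p + 0) ≟ᴸ g (p + 2) ×-dec g (p + 1) ≟ᴸ g (p + 3))

squareFree-blocks : ∀ b x y → x ≢ y → ∀ {r} → r < 3 →
                    SquareFree₄ (factor (letterAt (step b (x ∷ y ∷ []))) r 4)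
squareFree-blocks = from-yes (∀-Bool? λ b → ∀-Letter? λ x → ∀-Letter? λ y →
  ¬? (x ≟ᴸ y) →-dec allUpTo? (squareFree₄? (letterAt (step b (x ∷ y ∷ [])))) 3)

w-squareFree₄ : ∀ n → SquareFree₄ (factor w n 4)
w-squareFree₄ = <-rec (λ n → SquareFree₄ (factor w n 4)) λ where
  zero      _   → from-yes (squareFree₄? w 0)
  n@(suc _) rec → subst SquareFree₄ (sym (factor-in-step n 2 (m%3+n≤2+n n 4)))
                        (squareFree-blocks (isOdd (n / 3)) _ _
                                           (proj₁ (rec (m/n<m n 3 (s≤s (s≤s z≤n))))) (m%n<n n 3))

-- Blocks of even index ascend cyclically (x, x+1, x+2) and blocks of odd index descend
-- (x+2, x+1, x), so the direction of a step inside a block reveals the position modulo 6; a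
-- step across a block boundary reveals nothing.
fits : ℕ → Letter → Letter → Bool
fits 0 x y = does (y ≟ᴸ next x)
fits 1 x y = does (y ≟ᴸ next x)
fits 3 x y = does (x ≟ᴸ next y)
fits 4 x y = does (x ≟ᴸ next y)
fits _ _ _ = true

fitsFrom : ℕ → Word → Bool
fitsFrom c (x ∷ y ∷ u) = fits (c % 6) x y ∧ fitsFrom (suc c) (y ∷ u)
fitsFrom c _           = true

firstFit : ℕ → ℕ → Word → ℕ
firstFit c zero    u = c
firstFit c (suc k) u = if fitsFrom c u then c else firstFit (suc c) k u

phase : Word → ℕ
phase = firstFit 0 5

blockClass : Bool → ℕ → ℕ
blockClass b r = if b then 3 + r else r

phase-blocks : ∀ b x₀ x₁ x₂ x₃ → SquareFree₄ (x₀ ∷ x₁ ∷ x₂ ∷ x₃ ∷ []) → ∀ {r} → r < 3 →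
               phase (factor (letterAt (step b (x₀ ∷ x₁ ∷ x₂ ∷ x₃ ∷ []))) r 10) ≡ blockClass b r
phase-blocks = from-yes (∀-Bool? λ b → ∀-Letter? λ x₀ → ∀-Letter? λ x₁ → ∀-Letter? λ x₂ → ∀-Letter? λ x₃ →
  let u = x₀ ∷ x₁ ∷ x₂ ∷ x₃ ∷ [] in
  squareFree₄? (letterAt u) 0 →-dec
  allUpTo? (λ r → phase (factor (letterAt (step b u)) r 10) ≟ blockClass b r) 3)

block-mod6 : ∀ i {r} → r < 3 → (i * 3 + r) % 6 ≡ blockClass (isOdd i) r
block-mod6 0             r<3 = m<n⇒m%n≡m (<-≤-trans r<3 (m≤m+n 3 3))
block-mod6 1             r<3 = m<n⇒m%n≡m (+-monoʳ-< 3 r<3)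
block-mod6 (suc (suc i)) {r} r<3 = trans (%-remove-+ˡ (i * 3 + r) (∣-refl {6})) (block-mod6 i r<3)

phase-factor : ∀ p → phase (factor w p 10) ≡ p % 6
phase-factor p = begin
  phase (factor w p 10)
    ≡⟨ cong phase (factor-in-step p 4 (m%3+n≤2+n p 10)) ⟩
  phase (factor (letterAt (step (isOdd i) (factor w i 4))) r 10)
    ≡⟨ phase-blocks (isOdd i) _ _ _ _ (w-squareFree₄ i) (m%n<n p 3) ⟩
  blockClass (isOdd i) r
    ≡⟨ block-mod6 i (m%n<n p 3) ⟨
  (i * 3 + r) % 6
    ≡⟨ cong (_% 6) (divMod3 p) ⟨
  p % 6
    ∎
  where
  open ≡-Reasoning
  i = p / 3
  r = p % 3

window-residue : ∀ {p q} → factor w p 10 ≡ factor w q 10 → p % 6 ≡ q % 6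
window-residue {p} {q} e = trans (sym (phase-factor p)) (trans (cong phase e) (phase-factor q))

-- Length functions of morphisms fixing w

[m+d]%n≡m%n⇒n∣d : ∀ m d n .{{_ : NonZero n}} → (m + d) % n ≡ m % n → n ∣ d
[m+d]%n≡m%n⇒n∣d m d n same = divides ((r + d) / n) (+-cancelˡ-≡ r d _ (begin
  r + d                        ≡⟨ m≡m%n+[m/n]*n (r + d) n ⟩
  (r + d) % n + (r + d) / n * n ≡⟨ cong (_+ (r + d) / n * n) r+d≡r ⟩
  r + (r + d) / n * n          ∎))
  where
  open ≡-Reasoning
  r = m % n
  q = m / n
  r+d≡r : (r + d) % n ≡ r
  r+d≡r = begin
    (r + d) % n         ≡⟨ [m+kn]%n≡m%n (r + d) q n ⟨
    (r + d + q * n) % n ≡⟨ cong (_% n) (begin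
      r + d + q * n       ≡⟨ +-assoc r d (q * n) ⟩
      r + (d + q * n)     ≡⟨ cong (r +_) (+-comm d (q * n)) ⟩
      r + (q * n + d)     ≡⟨ +-assoc r (q * n) d ⟨
      r + q * n + d       ≡⟨ cong (_+ d) (m≡m%n+[m/n]*n m n) ⟨
      m + d               ∎) ⟩
    (m + d) % n         ≡⟨ same ⟩
    r                   ∎

∣-summands : ∀ {d a b c} → d ∣ a + b → d ∣ a + c → d ∣ a + b + c → d ∣ a × d ∣ b × d ∣ c
∣-summands {d} {a} {b} {c} d∣a+b d∣a+c d∣a+b+c = d∣a , ∣m+n∣m⇒∣n d∣a+b d∣a , d∣c
  where
  d∣c : d ∣ c
  d∣c = ∣m+n∣m⇒∣n d∣a+b+c d∣a+b
  d∣a : d ∣ a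
  d∣a = ∣m+n∣m⇒∣n (subst (d ∣_) (+-comm a c) d∣a+c) d∣c

6∣⇒2∣/3 : ∀ {n} → 6 ∣ n → 2 ∣ n / 3
6∣⇒2∣/3 (divides-refl q) = divides q (trans (cong (_/ 3) (sym (*-assoc q 2 3))) (m*n/n≡m (q * 2) 3))

sumUpTo : (ℕ → ℕ) → ℕ → ℕ
sumUpTo h zero    = 0
sumUpTo h (suc i) = h 0 + sumUpTo (h ∘ suc) i

sumUpTo-+ : ∀ h i k → sumUpTo h (i + k) ≡ sumUpTo h i + sumUpTo (λ t → h (i + t)) k
sumUpTo-+ h zero    k = refl
sumUpTo-+ h (suc i) k = trans (cong (h 0 +_) (sumUpTo-+ (h ∘ suc) i k)) (sym (+-assoc (h 0) _ _))

sumUpTo-cong : ∀ {h h′} i → (∀ t → h t ≡ h′ t) → sumUpTo h i ≡ sumUpTo h′ i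
sumUpTo-cong zero    eq = refl
sumUpTo-cong (suc i) eq = cong₂ _+_ (eq 0) (sumUpTo-cong i (eq ∘ suc))

sumUpTo-*ʳ : ∀ h k i → sumUpTo (λ t → h t * k) i ≡ sumUpTo h i * k
sumUpTo-*ʳ h k zero    = refl
sumUpTo-*ʳ h k (suc i) = trans (cong (h 0 * k +_) (sumUpTo-*ʳ (h ∘ suc) k i)) (sym (*-distribʳ-+ k (h 0) _))

∣-sumUpTo : ∀ {d h} i → (∀ t → d ∣ h t) → d ∣ sumUpTo h i
∣-sumUpTo {d} zero    _   = d ∣0
∣-sumUpTo     (suc i) d∣h = ∣m∣n⇒∣m+n (d∣h 0) (∣-sumUpTo i (d∣h ∘ suc))

offset : (Letter → ℕ) → ℕ → ℕ
offset f = sumUpTo (f ∘ w)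

firstOcc : Letter → ℕ
firstOcc l1 = 0
firstOcc l2 = 1
firstOcc l3 = 2

w-firstOcc : ∀ x → w (firstOcc x) ≡ x
w-firstOcc l1 = refl
w-firstOcc l2 = refl
w-firstOcc l3 = refl

-- A morphism ψ with |ψ x| = f x fixes w iff cutting w at the positions offset f i yields
-- blocks depending only on the letter w i; ψ x is then the block at the first occurrence of x.
BlockFixed : (Letter → ℕ) → ℕ → Set
BlockFixed f i = ∀ {j} → j < f (w i) → w (offset f (firstOcc (w i)) + j) ≡ w (offset f i + j)

FixingLengths : (Letter → ℕ) → Set
FixingLengths f = ∀ i → BlockFixed f i

BlockFixed-resp : ∀ {f g} → (∀ x → f x ≡ g x) → ∀ {i} → BlockFixed f i → BlockFixed g i
BlockFixed-resp {f} {g} eq {i} fixed {j} j<g =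
  subst₂ (λ m n → w (m + j) ≡ w (n + j)) (offset-eq (firstOcc (w i))) (offset-eq i)
         (fixed (subst (j <_) (sym (eq (w i))) j<g))
  where
  offset-eq : ∀ n → offset f n ≡ offset g n
  offset-eq n = sumUpTo-cong n (eq ∘ w)

third : (Letter → ℕ) → Letter → ℕ
third f x = f x / 3

lengths : ℕ → ℕ → ℕ → Letter → ℕ
lengths a b c l1 = a
lengths a b c l2 = b
lengths a b c l3 = c

blockFixed? : ∀ f i → Dec (BlockFixed f i)
blockFixed? f i = allUpTo? (λ j → w (offset f (firstOcc (w i)) + j) ≟ᴸ w (offset f i + j)) (f (w i))

short-fixing-check : ∀ {a} → a < 10 → ∀ {b} → b < 10 → ∀ {c} → c < 10 → 0 < a →
                     (∀ {i} → i < 6 → BlockFixed (lengths a b c) i) → a ≡ 1 × b ≡ 1 × c ≡ 1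
short-fixing-check = from-yes (allUpTo? (λ a → allUpTo? (λ b → allUpTo? (λ c →
  (0 <? a) →-dec allUpTo? (blockFixed? (lengths a b c)) 6 →-dec ((a ≟ 1) ×-dec (b ≟ 1) ×-dec (c ≟ 1)))
  10) 10) 10)

module _ {f : Letter → ℕ} (fixing : FixingLengths f) where

  long-return : ∀ {i k} → 10 ≤ f (w i) → w (i + k) ≡ w i → 6 ∣ sumUpTo (λ t → f (w (i + t))) k
  long-return {i} {k} long e = [m+d]%n≡m%n⇒n∣d (offset f i) _ 6 (begin
    (offset f i + sumUpTo (λ t → f (w (i + t))) k) % 6  ≡⟨ cong (_% 6) (sumUpTo-+ (f ∘ w) i k) ⟨
    offset f (i + k) % 6                                 ≡⟨ window-residue {offset f (i + k)} {offset f i} (begin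
      factor w (offset f (i + k)) 10                       ≡⟨ window (i + k) (subst (λ x → 10 ≤ f x) (sym e) long) ⟨
      factor w (offset f (firstOcc (w (i + k)))) 10        ≡⟨ cong (λ x → factor w (offset f (firstOcc x)) 10) e ⟩
      factor w (offset f (firstOcc (w i))) 10              ≡⟨ window i long ⟩
      factor w (offset f i) 10                             ∎) ⟩
    offset f i % 6                                       ∎)
    where
    open ≡-Reasoning
    window : ∀ n → 10 ≤ f (w n) → factor w (offset f (firstOcc (w n))) 10 ≡ factor w (offset f n) 10
    window n long = applyUpTo-cong 10 (λ t<10 → fixing n (<-≤-trans t<10 long))

  return₂ : ∀ i → 10 ≤ f (w i) → w (i + 2) ≡ w i → 6 ∣ f (w (i + 0)) + f (w (i + 1))
  return₂ i long e = subst (6 ∣_) (cong (f (w (i + 0)) +_) (+-identityʳ _)) (long-return {i} {2} long e)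

  return₃ : ∀ i → 10 ≤ f (w i) → w (i + 3) ≡ w i → 6 ∣ f (w (i + 0)) + f (w (i + 1)) + f (w (i + 2))
  return₃ i long e =
    subst (6 ∣_) (trans (cong (λ n → a + (b + n)) (+-identityʳ c)) (sym (+-assoc a b c)))
          (long-return {i} {3} long e)
    where
    a = f (w (i + 0))
    b = f (w (i + 1))
    c = f (w (i + 2))

  -- The positions are those of the factors x(x+1)x, x(x+2)x and x(x+1)(x+2)x of w.
  long⇒6∣ : ∀ x → 10 ≤ f x → ∀ y → 6 ∣ f y
  long⇒6∣ l1 long = every-letter l1 (∣-summands (return₂ 13 long refl) (return₂ 11 long refl) (return₃ 0 long refl))
  long⇒6∣ l2 long = every-letter l2 (∣-summands (return₂ 8 long refl) (return₂ 22 long refl) (return₃ 5 long refl))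
  long⇒6∣ l3 long = every-letter l3 (∣-summands (return₂ 2 long refl) (return₂ 4 long refl) (return₃ 6 long refl))

  third-fixing : (∀ x → 6 ∣ f x) → FixingLengths (third f)
  third-fixing 6∣f i {j} j<g = blockLetter-injective₀ (isOdd j) _ _ (begin
    blockLetter (isOdd j) (w (offset g a + j)) 0   ≡⟨ tripled a ⟨
    w (offset f a + j * 3)                         ≡⟨ fixing i j*3<f ⟩
    w (offset f i + j * 3)                         ≡⟨ tripled i ⟩
    blockLetter (isOdd j) (w (offset g i + j)) 0   ∎)
    where
    open ≡-Reasoning
    g = third f
    a = firstOcc (w i)
    f≡g*3 : ∀ x → f x ≡ g x * 3
    f≡g*3 x = sym (m/n*n≡m (m*n∣⇒n∣ 2 3 (6∣f x)))
    j*3<f : j * 3 < f (w i)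
    j*3<f = subst (j * 3 <_) (sym (f≡g*3 (w i))) (*-monoˡ-< 3 j<g)
    tripled : ∀ n → w (offset f n + j * 3) ≡ blockLetter (isOdd j) (w (offset g n + j)) 0
    tripled n = begin
      w (offset f n + j * 3)
        ≡⟨ cong (λ m → w (m + j * 3)) (trans (sumUpTo-cong n (f≡g*3 ∘ w)) (sumUpTo-*ʳ (g ∘ w) 3 n)) ⟩
      w (offset g n * 3 + j * 3)
        ≡⟨ cong w (trans (sym (*-distribʳ-+ 3 (offset g n) j)) (sym (+-identityʳ _))) ⟩
      w ((offset g n + j) * 3 + 0)
        ≡⟨ w-block (offset g n + j) z<s ⟩
      blockLetter (isOdd (offset g n + j)) (w (offset g n + j)) 0
        ≡⟨ cong (λ b → blockLetter b (w (offset g n + j)) 0)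
                (isOdd-+-even j (∣-sumUpTo n (6∣⇒2∣/3 ∘ 6∣f ∘ w))) ⟩
      blockLetter (isOdd j) (w (offset g n + j)) 0
        ∎

  short⇒unit : (∀ x → f x < 10) → 0 < f l1 → ∀ x → f x ≡ 1
  short⇒unit short pos = every-letter l1
    (short-fixing-check (short l1) (short l2) (short l3) pos (λ {i} _ → BlockFixed-resp tabulated {i} (fixing i)))
    where
    tabulated : ∀ x → f x ≡ lengths (f l1) (f l2) (f l3) x
    tabulated l1 = refl
    tabulated l2 = refl
    tabulated l3 = refl

fixing⇒unit : ∀ {f} → FixingLengths f → 0 < f l1 → ∀ x → f x ≡ 1
fixing⇒unit {f} = <-rec P descend (f l1) refl
  where
  P : ℕ → Set
  P n = ∀ {f} → f l1 ≡ n → FixingLengths f → 0 < f l1 → ∀ x → f x ≡ 1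
  descend : ∀ n → (∀ {m} → m < n → P m) → P n
  descend _ rec {f} refl fixing pos with ∃-Letter? (λ x → 10 ≤? f x)
  ... | no ¬long       = short⇒unit fixing (λ x → ≰⇒> (¬long ∘ (x ,_))) pos
  ... | yes (x , long) = contradiction (∣1⇒≡1 (subst (2 ∣_) third-unit (6∣⇒2∣/3 (6∣f l1)))) λ ()
    where
    6∣f = long⇒6∣ fixing x long
    instance f-l1-nonZero = >-nonZero pos
    third-unit : third f l1 ≡ 1
    third-unit = rec (m/n<m (f l1) 3 (s≤s (s≤s z≤n))) {third f} refl (third-fixing fixing 6∣f)
                     (m≥n⇒m/n>0 (≤-trans (s≤s (s≤s (s≤s z≤n))) (∣⇒≤ (6∣f l1)))) l1

-- From a morphism to its length function

at-concatMap : ∀ (φ : Morphism) (g : ℕ → Letter) u {i j} →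
               (∀ {m y} → at u m ≡ just y → y ≡ g m) → i < length u → j < length (φ (g i)) →
               at (concatMap φ u) (sumUpTo (λ t → length (φ (g t))) i + j) ≡ at (φ (g i)) j
at-concatMap φ g (x ∷ u) {zero} agrees _ j< with agrees {0} refl
... | refl = at-++ˡ (φ (g 0)) j<
at-concatMap φ g (x ∷ u) {suc i} {j} agrees (s≤s i<) j< with agrees {0} refl
... | refl = begin
  at (φ (g 0) ++ concatMap φ u) (length (φ (g 0)) + s + j)
    ≡⟨ cong (at (φ (g 0) ++ concatMap φ u)) (+-assoc (length (φ (g 0))) s j) ⟩
  at (φ (g 0) ++ concatMap φ u) (length (φ (g 0)) + (s + j))
    ≡⟨ at-++ʳ (φ (g 0)) (s + j) ⟩
  at (concatMap φ u) (s + j)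
    ≡⟨ at-concatMap φ (g ∘ suc) u agrees i< j< ⟩
  at (φ (g (suc i))) j
    ∎
  where
  open ≡-Reasoning
  s = sumUpTo (λ t → length (φ (g (suc t)))) i

length-iterM-unit : ∀ (φ : Morphism) → (∀ x → length (φ x) ≡ 1) → ∀ k u → length (iterM φ k u) ≡ length u
length-iterM-unit φ unit zero    u = refl
length-iterM-unit φ unit (suc k) u = trans (length-concatMap (iterM φ k u)) (length-iterM-unit φ unit k u)
  where
  length-concatMap : ∀ v → length (concatMap φ v) ≡ length v
  length-concatMap []      = refl
  length-concatMap (x ∷ v) = trans (length-++ (φ x)) (cong₂ _+_ (unit x) (length-concatMap v))

beginsWith-∷ : ∀ {u x} → BeginsWith u x → ∃ λ t → u ≡ x ∷ t
beginsWith-∷ {y ∷ t} refl = t , refl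

module FixedPoint {φ : Morphism} {a : Letter} (begins : BeginsWith (φ a) a)
                  (unbounded : Unbounded φ a) (limit : LimitIs φ a arshon) where

  iterate : ℕ → Word
  iterate k = iterM φ k (a ∷ [])

  iterate-grows : ∀ k → iterate k ≼ iterate (suc k)
  iterate-grows zero = proj₁ (beginsWith-∷ begins) ++ [] , cong (_++ []) (proj₂ (beginsWith-∷ begins))
  iterate-grows (suc k) with iterate-grows k
  ... | t , e = concatMap φ t , trans (cong (concatMap φ) e) (concatMap-++ φ (iterate k) t)

  iterate-agrees : ∀ {k n y} → at (iterate k) n ≡ just y → y ≡ w n
  iterate-agrees {k} = PrefixChain.limit-unique iterate iterate-grows limit {k}

  imageLength : Letter → ℕ
  imageLength x = length (φ x)

  image-in-w : ∀ i {j} → j < imageLength (w i) → at (φ (w i)) j ≡ just (w (offset imageLength i + j))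
  image-in-w i {j} j< with unbounded i
  ... | k , i<length = trans e (cong just (iterate-agrees {suc k}
          (trans (at-concatMap φ w (iterate k) (iterate-agrees {k}) i<length j<) e)))
    where
    e = at-letterAt (φ (w i)) j<

  fixing : FixingLengths imageLength
  fixing i {j} j< = just-injective (begin
    just (w (offset imageLength i′ + j))   ≡⟨ image-in-w i′ (subst (λ x → j < imageLength x) (sym first) j<) ⟨
    at (φ (w i′)) j                        ≡⟨ cong (λ x → at (φ x) j) first ⟩
    at (φ (w i)) j                         ≡⟨ image-in-w i j< ⟩
    just (w (offset imageLength i + j))    ∎)
    where
    open ≡-Reasoning
    i′ = firstOcc (w i)
    first = w-firstOcc (w i)

  nonempty : 0 < imageLength l1
  nonempty = subst (λ x → 0 < imageLength x) (iterate-agrees {0} {0} refl)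
                   (subst (λ u → 0 < length u) (sym (proj₂ (beginsWith-∷ begins))) z<s)

theorem1 : ¬ (∃₂ λ (φ : Morphism) (a : Letter) → FixedPointFrom φ a arshon)
theorem1 (φ , a , begins , unbounded , limit) with unbounded 1
... | k , 1<length = <-irrefl refl (subst (1 <_) (length-iterM-unit φ unit k (a ∷ [])) 1<length)
  where
  open FixedPoint begins unbounded limit
  unit : ∀ x → length (φ x) ≡ 1
  unit = fixing⇒unit fixing nonempty
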